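{- Let $t_1, t_2, r$ be integers with $0 \leq t_1 < t_2 \leq r$, let $\mathcal{H}$ be a hereditary family with $\mu(\mathcal{H}) \geq 2r - t_1$, let $\emptyset \neq S \subseteq [t_2,r]$, and let $\mathcal{F} := \bigcup_{s \in S}\mathcal{H}^{(s)}$. If $T_1$ is a $t_1$-subset of a $t_2$-set $T_2$ such that $\mathcal{F}\langle T_2 \rangle \neq \emptyset$, then \[|\mathcal{F}\langle T_1 \rangle| > \frac{\binom{\mu(\mathcal{H}) - r}{t_2 - t_1}}{\binom{r-t_1}{t_2 - t_1}} |\mathcal{F} \langle T_2 \rangle|.\]
   Context: All sets and families are finite. For integers $m \le n$, $[m,n] := \{i \in \{1,2,\dots\} : m \le i \le n\}$. A family $\mathcal{H}$ is hereditary if every subset of every member of $\mathcal{H}$ is a member of $\mathcal{H}$. A base of a family $\mathcal{F}$ is a set $B \in \mathcal{F}$ that is not a proper subset of any member of $\mathcal{F}$; $\mu(\mathcal{F})$ denotes the size of a smallest base of $\mathcal{F}$. $\mathcal{H}^{(s)} := \{H \in \mathcal{H} : |H| = s\}$. For a family $\mathcal{F}$ and a set $T$, $\mathcal{F}\langle T\rangle := \{F \in \mathcal{F} : T \subseteq F\}$. -}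

module Defs where

open import Data.Nat using (ℕ; zero; suc; _≤_)
open import Data.Bool using (Bool; true; false; _∧_)
open import Data.List using (List; []; _∷_; map; _++_; length; filterᵇ)
open import Data.Fin.Subset using (Subset; _⊆_; _⊂_; ∣_∣; inside; outside)
open import Data.Fin.Subset.Properties using (_⊆?_)
open import Data.Vec using ([]; _∷_)
open import Data.Product using (Σ; _×_)
open import Relation.Nullary using (¬_; does)
open import Relation.Binary.PropositionalEquality using (_≡_)

Family : ℕ → Set
Family n = Subset n → Bool

_∈F_ : ∀ {n} → Subset n → Family n → Set
X ∈F ℋ = ℋ X ≡ true

allSubsets : (n : ℕ) → List (Subset n)
allSubsets zero = [] ∷ []
allSubsets (suc n) = map (outside ∷_) (allSubsets n) ++ map (inside ∷_) (allSubsets n)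

∣_∣F : ∀ {n} → Family n → ℕ
∣_∣F {n} ℱ = length (filterᵇ ℱ (allSubsets n))

Hereditary : ∀ {n} → Family n → Set
Hereditary {n} ℋ = (X Y : Subset n) → Y ⊆ X → X ∈F ℋ → Y ∈F ℋ

IsBase : ∀ {n} → Family n → Subset n → Set
IsBase {n} ℱ B = B ∈F ℱ × ((X : Subset n) → X ∈F ℱ → ¬ (B ⊂ X))

IsMu : ∀ {n} → Family n → ℕ → Set
IsMu {n} ℱ m =
  (Σ (Subset n) λ B → IsBase ℱ B × ∣ B ∣ ≡ m) ×
  ((B : Subset n) → IsBase ℱ B → m ≤ ∣ B ∣)

-- ⋃_{s ∈ S} ℋ^(s), with S given by a Boolean membership test on ℕ.
layers : ∀ {n} → Family n → (ℕ → Bool) → Family n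
layers ℋ S X = ℋ X ∧ S ∣ X ∣

_⟨_⟩ : ∀ {n} → Family n → Subset n → Family n
(ℱ ⟨ T ⟩) X = ℱ X ∧ does (T ⊆? X)

module Submission where

open import Defs
open import Data.Nat using (ℕ; _≤_; _<_; _*_; _∸_)
open import Data.Nat.Combinatorics using (_C_)
open import Data.Bool using (Bool; true)
open import Data.Fin.Subset using (Subset; _⊆_; ∣_∣)
open import Data.Product using (Σ)
open import Relation.Binary.PropositionalEquality using (_≡_; _≢_)

-- Lemma 4.3 by double counting an exchange relation.
--
-- Write ℱ = ⋃_{s ∈ S} ℋ^(s), D = T₂ ─ T₁ and k = |D| = t₂ − t₁.  Call G an exchange of F when
-- T₁ ⊆ F, G ∈ ℱ, F ─ G = D and |G ─ F| = k.
--   * Each F ∈ ℱ⟨T₂⟩ has at least C(μ − r, k) exchanges: extend F to a base B of ℋ, so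
--     |B ─ F| ≥ μ − r, and for every k-subset A of B ─ F the set (F ─ D) ∪ A lies below B and
--     has the size of F, hence belongs to ℱ.
--   * Each exchange G lies in ℱ⟨T₁⟩ but does not contain T₂, and it is an exchange of at most
--     C(r − t₁, k) sets F, because F is determined by the k-subset G ─ F of G ─ T₁.
-- Double counting gives C(μ−r,k)·|ℱ⟨T₂⟩| ≤ C(r−t₁,k)·|ℱ⟨T₁⟩ ∖ ℱ⟨T₂⟩|; as ℱ⟨T₂⟩ ≠ ∅ and
-- |ℱ⟨T₁⟩| = |ℱ⟨T₂⟩| + |ℱ⟨T₁⟩ ∖ ℱ⟨T₂⟩|, the strict inequality follows.

open import Level using (Level)
open import Function using (_∘_; _⇔_; mk⇔; Equivalence)
open import Data.Nat using (zero; suc; _+_; z≤n; s≤s; s≤s⁻¹; _≤ᵇ_; _≤′_; ≤′-refl; ≤′-step)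
open import Data.Nat.Properties
open import Data.Nat.Combinatorics using (nCk+nC[k+1]≡[n+1]C[k+1])
import Data.Bool as Bool
open import Data.Bool using (false; _∧_; not; if_then_else_)
import Data.Bool.Properties as Boolₚ
open import Data.Vec using ([]; _∷_; here)
open import Data.Vec.Properties using (≡-dec)
open import Data.List using (List; []; _∷_; map; _++_; length; filterᵇ)
open import Data.List.Properties using (length-++; filter-++)
open import Data.Product using (_×_; _,_; proj₁; proj₂; ∃)
open import Data.Sum using ([_,_]′)
open import Data.Fin.Subset using (inside; outside; _─_; _∪_; _⊂_)
open import Data.Fin.Subset.Properties
  using (_⊆?_; ⊆-refl; ⊆-reflexive; ⊆-trans; drop-∷-⊆; out⊆; in⊆in; p─q⊆p; p⊂q⇒∣p∣<∣q∣; x∈p∪q⁻)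
open import Relation.Nullary using (¬_; Dec; yes; no; does; contradiction)
open import Relation.Nullary.Reflects using (ofʸ; ofⁿ)
open import Relation.Nullary.Decidable using (T?; dec-true; dec-false; does-⇔; _×-dec_)
open import Relation.Unary using (Pred; Decidable)
open import Relation.Unary.Properties using (_∩?_; ∁?)
open import Relation.Binary.Definitions using (DecidableEquality)
open import Relation.Binary.PropositionalEquality
  using (refl; sym; trans; cong; cong₂; subst; module ≡-Reasoning)
open import Algebra.Properties.CommutativeSemigroup +-commutativeSemigroup
  using (interchange)

private
  variable
    n : ℕ
    ℓ : Level

∑ : (Subset n → ℕ) → ℕ
∑ {zero}  f = f []
∑ {suc n} f = ∑ (f ∘ (outside ∷_)) + ∑ (f ∘ (inside ∷_))

∑-cong : {f g : Subset n → ℕ} → (∀ x → f x ≡ g x) → ∑ f ≡ ∑ g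
∑-cong {zero}  e = e []
∑-cong {suc n} e = cong₂ _+_ (∑-cong (e ∘ (outside ∷_))) (∑-cong (e ∘ (inside ∷_)))

∑-mono : {f g : Subset n → ℕ} → (∀ x → f x ≤ g x) → ∑ f ≤ ∑ g
∑-mono {zero}  e = e []
∑-mono {suc n} e = +-mono-≤ (∑-mono (e ∘ (outside ∷_))) (∑-mono (e ∘ (inside ∷_)))

∑-vanish : {f : Subset n → ℕ} → (∀ x → f x ≡ 0) → ∑ f ≡ 0
∑-vanish {zero}  f≡0 = f≡0 []
∑-vanish {suc n} f≡0 = cong₂ _+_ (∑-vanish (f≡0 ∘ (outside ∷_))) (∑-vanish (f≡0 ∘ (inside ∷_)))

∑-+ : (f g : Subset n → ℕ) → ∑ (λ x → f x + g x) ≡ ∑ f + ∑ g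
∑-+ {zero}  f g = refl
∑-+ {suc n} f g = begin
  ∑ (λ x → f (outside ∷ x) + g (outside ∷ x)) + ∑ (λ x → f (inside ∷ x) + g (inside ∷ x))
    ≡⟨ cong₂ _+_ (∑-+ (f ∘ (outside ∷_)) (g ∘ (outside ∷_))) (∑-+ (f ∘ (inside ∷_)) (g ∘ (inside ∷_))) ⟩
  (∑ (f ∘ (outside ∷_)) + ∑ (g ∘ (outside ∷_))) + (∑ (f ∘ (inside ∷_)) + ∑ (g ∘ (inside ∷_)))
    ≡⟨ interchange (∑ (f ∘ (outside ∷_))) (∑ (g ∘ (outside ∷_))) (∑ (f ∘ (inside ∷_))) (∑ (g ∘ (inside ∷_))) ⟩
  ∑ f + ∑ g ∎
  where open ≡-Reasoning

∑-*ˡ : (c : ℕ) (f : Subset n → ℕ) → ∑ (λ x → c * f x) ≡ c * ∑ f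
∑-*ˡ {zero}  c f = refl
∑-*ˡ {suc n} c f = trans (cong₂ _+_ (∑-*ˡ c (f ∘ (outside ∷_))) (∑-*ˡ c (f ∘ (inside ∷_))))
                         (sym (*-distribˡ-+ c _ _))

∑-swap : (f : Subset n → Subset n → ℕ) →
         ∑ (λ x → ∑ (λ y → f x y)) ≡ ∑ (λ y → ∑ (λ x → f x y))
∑-swap {zero}  f = refl
∑-swap {suc n} f = begin
  ∑ (λ x → ∑ (f (o x) ∘ o) + ∑ (f (o x) ∘ i)) + ∑ (λ x → ∑ (f (i x) ∘ o) + ∑ (f (i x) ∘ i))
    ≡⟨ cong₂ _+_ (∑-+ (λ x → ∑ (f (o x) ∘ o)) (λ x → ∑ (f (o x) ∘ i)))
                 (∑-+ (λ x → ∑ (f (i x) ∘ o)) (λ x → ∑ (f (i x) ∘ i))) ⟩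
  (oo + oi) + (io + ii)
    ≡⟨ interchange oo oi io ii ⟩
  (oo + io) + (oi + ii)
    ≡⟨ cong₂ _+_ (cong₂ _+_ (∑-swap (λ x y → f (o x) (o y))) (∑-swap (λ x y → f (i x) (o y))))
                 (cong₂ _+_ (∑-swap (λ x y → f (o x) (i y))) (∑-swap (λ x y → f (i x) (i y)))) ⟩
  (∑ (λ y → ∑ (λ x → f (o x) (o y))) + ∑ (λ y → ∑ (λ x → f (i x) (o y)))) +
  (∑ (λ y → ∑ (λ x → f (o x) (i y))) + ∑ (λ y → ∑ (λ x → f (i x) (i y))))
    ≡⟨ cong₂ _+_ (∑-+ (λ y → ∑ (λ x → f (o x) (o y))) (λ y → ∑ (λ x → f (i x) (o y))))
                 (∑-+ (λ y → ∑ (λ x → f (o x) (i y))) (λ y → ∑ (λ x → f (i x) (i y)))) ⟨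
  ∑ (λ y → ∑ (λ x → f (o x) (o y)) + ∑ (λ x → f (i x) (o y))) +
  ∑ (λ y → ∑ (λ x → f (o x) (i y)) + ∑ (λ x → f (i x) (i y))) ∎
  where
  open ≡-Reasoning
  o i : Subset _ → Subset _
  o = outside ∷_
  i = inside ∷_
  oo oi io ii : ℕ
  oo = ∑ (λ x → ∑ (λ y → f (o x) (o y)))
  oi = ∑ (λ x → ∑ (λ y → f (o x) (i y)))
  io = ∑ (λ x → ∑ (λ y → f (i x) (o y)))
  ii = ∑ (λ x → ∑ (λ y → f (i x) (i y)))

∑-nonzero : (f : Subset n → ℕ) → ∑ f ≢ 0 → ∃ λ x → f x ≢ 0
∑-nonzero {zero}  f ∑f≢0 = [] , ∑f≢0
∑-nonzero {suc n} f ∑f≢0 with ∑ (f ∘ (outside ∷_)) ≟ 0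
... | yes ∑o≡0 = let x , fx≢0 = ∑-nonzero (f ∘ (inside ∷_)) (∑f≢0 ∘ cong₂ _+_ ∑o≡0) in inside ∷ x , fx≢0
... | no ∑o≢0  = let x , fx≢0 = ∑-nonzero (f ∘ (outside ∷_)) ∑o≢0 in outside ∷ x , fx≢0

χ : Bool → ℕ
χ true  = 1
χ false = 0

count : {P : Pred (Subset n) ℓ} → Decidable P → ℕ
count P? = ∑ (λ x → χ (does (P? x)))

χ-does : {A : Set ℓ} (a? : Dec A) → χ (does a?) ≢ 0 → A
χ-does (yes a) _   = a
χ-does (no _)  χ≢0 = contradiction refl χ≢0

count-cong : {P Q : Pred (Subset n) ℓ} (P? : Decidable P) (Q? : Decidable Q) →
             (∀ x → P x ⇔ Q x) → count P? ≡ count Q?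
count-cong P? Q? P⇔Q = ∑-cong λ x → cong χ (does-⇔ (P⇔Q x) (P? x) (Q? x))

count-none : {P : Pred (Subset n) ℓ} (P? : Decidable P) → (∀ x → ¬ P x) → count P? ≡ 0
count-none P? ¬P = ∑-vanish λ x → cong χ (dec-false (P? x) (¬P x))

count-split : {P Q : Pred (Subset n) ℓ} (P? : Decidable P) (Q? : Decidable Q) →
              count P? ≡ count (P? ∩? Q?) + count (P? ∩? ∁? Q?)
count-split P? Q? =
  trans (∑-cong λ x → χ-split (does (P? x)) (does (Q? x)))
        (∑-+ (λ x → χ (does (P? x) ∧ does (Q? x))) (λ x → χ (does (P? x) ∧ not (does (Q? x)))))
  where
  χ-split : (a b : Bool) → χ a ≡ χ (a ∧ b) + χ (a ∧ not b)
  χ-split false _     = refl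
  χ-split true  true  = refl
  χ-split true  false = refl

infix 4 _≟ˢ_
_≟ˢ_ : DecidableEquality (Subset n)
_≟ˢ_ = ≡-dec Bool._≟_

count-≡ : (a : Subset n) → count (a ≟ˢ_) ≡ 1
count-≡ []                    = refl
count-≡ {suc n} (outside ∷ a) = cong₂ _+_ (count-≡ a) (∑-vanish {n} λ _ → refl)
count-≡ {suc n} (inside ∷ a)  = cong₂ _+_ (∑-vanish {n} λ _ → refl) (count-≡ a)

count-≤1 : {P : Pred (Subset n) ℓ} (P? : Decidable P) →
           (∀ {x y} → P x → P y → x ≡ y) → count P? ≤ 1
count-≤1 {P = P} P? unique with count P? ≟ 0
... | yes count≡0 = ≤-trans (≤-reflexive count≡0) z≤n
... | no count≢0 with ∑-nonzero (λ x → χ (does (P? x))) count≢0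
...   | a , χ≢0 = begin
  count P?       ≤⟨ ∑-mono at-most-a ⟩
  count (a ≟ˢ_)  ≡⟨ count-≡ a ⟩
  1              ∎
  where
  open ≤-Reasoning
  Pa : P a
  Pa = χ-does (P? a) χ≢0
  at-most-a : ∀ x → χ (does (P? x)) ≤ χ (does (a ≟ˢ x))
  at-most-a x with P? x
  ... | yes Px = ≤-reflexive (cong χ (sym (dec-true (a ≟ˢ x) (unique Pa Px))))
  ... | no _   = z≤n

-- Injection bound: an injective map from P into Q shows #P ≤ #Q.  Each x ∈ P is counted
-- once in the fibre of f x, and each fibre over y has at most one element and is empty unless y ∈ Q.
count-inj : {P Q : Pred (Subset n) ℓ} (P? : Decidable P) (Q? : Decidable Q)
            (f : Subset n → Subset n) → (∀ {x} → P x → Q (f x)) →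
            (∀ {x y} → P x → P y → f x ≡ f y → x ≡ y) → count P? ≤ count Q?
count-inj {n = n} {P = P} {Q = Q} P? Q? f P⇒Qf f-inj = begin
  count P?                                        ≡⟨ ∑-cong sum-of-fibres ⟩
  ∑ (λ x → ∑ (λ y → χ (does (fibre y x))))        ≡⟨ ∑-swap (λ x y → χ (does (fibre y x))) ⟩
  ∑ (λ y → count (fibre y))                       ≤⟨ ∑-mono fibre-bound ⟩
  count Q?                                        ∎
  where
  open ≤-Reasoning
  fibre : ∀ y → Decidable (λ x → P x × f x ≡ y)
  fibre y x = P? x ×-dec (f x ≟ˢ y)
  sum-of-fibres : ∀ x → χ (does (P? x)) ≡ ∑ (λ y → χ (does (fibre y x)))
  sum-of-fibres x with does (P? x)
  ... | true  = sym (count-≡ (f x))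
  ... | false = sym (∑-vanish {n} λ _ → refl)
  fibre-bound : ∀ y → count (fibre y) ≤ χ (does (Q? y))
  fibre-bound y with Q? y
  ... | yes _  = count-≤1 (fibre y) λ (Px , fx≡y) (Px′ , fx′≡y) → f-inj Px Px′ (trans fx≡y (sym fx′≡y))
  ... | no ¬Qy = ≤-reflexive (count-none (fibre y) λ x (Px , fx≡y) → ¬Qy (subst Q fx≡y (P⇒Qf Px)))

-- Double counting: if each x ∈ P is R-related to at least a elements, each y ∈ Q is
-- R-related from at most b elements, and only elements of Q are R-related from anything,
-- then a·#P ≤ b·#Q (count the pairs in R by rows and by columns).
double-count : {P Q : Pred (Subset n) ℓ} {R : Subset n → Subset n → Set ℓ}
               (P? : Decidable P) (Q? : Decidable Q) (R? : ∀ x y → Dec (R x y)) (a b : ℕ) →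
               (∀ {x} → P x → a ≤ count (R? x)) →
               (∀ {y} → Q y → count (λ x → R? x y) ≤ b) →
               (∀ {x y} → R x y → Q y) →
               a * count P? ≤ b * count Q?
double-count P? Q? R? a b out-degree in-degree R⇒Q = begin
  a * count P?                               ≡⟨ ∑-*ˡ a (λ x → χ (does (P? x))) ⟨
  ∑ (λ x → a * χ (does (P? x)))              ≤⟨ ∑-mono lower ⟩
  ∑ (λ x → count (R? x))                     ≡⟨ ∑-swap (λ x y → χ (does (R? x y))) ⟩
  ∑ (λ y → count (λ x → R? x y))             ≤⟨ ∑-mono upper ⟩
  ∑ (λ y → b * χ (does (Q? y)))              ≡⟨ ∑-*ˡ b (λ y → χ (does (Q? y))) ⟩
  b * count Q?                               ∎
  where
  open ≤-Reasoning
  lower : ∀ x → a * χ (does (P? x)) ≤ count (R? x)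
  lower x with P? x
  ... | yes Px = ≤-trans (≤-reflexive (*-identityʳ a)) (out-degree Px)
  ... | no _   = ≤-trans (≤-reflexive (*-zeroʳ a)) z≤n
  upper : ∀ y → count (λ x → R? x y) ≤ b * χ (does (Q? y))
  upper y with Q? y
  ... | yes Qy = ≤-trans (in-degree Qy) (≤-reflexive (sym (*-identityʳ b)))
  ... | no ¬Qy = ≤-trans (≤-reflexive (count-none (λ x → R? x y) λ x Rxy → ¬Qy (R⇒Q Rxy))) z≤n

∧-≡-true : {a b : Bool} → (a ∧ b ≡ true) ⇔ (a ≡ true × b ≡ true)
∧-≡-true {true}  = mk⇔ (refl ,_) proj₂
∧-≡-true {false} = mk⇔ (λ ()) (λ ())

member? : (ℱ : Family n) → Decidable (_∈F ℱ)
member? ℱ X = ℱ X Bool.≟ true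

∈layers⇔ : (ℋ : Family n) (S : ℕ → Bool) (X : Subset n) →
           X ∈F layers ℋ S ⇔ (X ∈F ℋ × S ∣ X ∣ ≡ true)
∈layers⇔ ℋ S X = ∧-≡-true

∈⟨⟩⁻ : (ℱ : Family n) (T : Subset n) {X : Subset n} → X ∈F (ℱ ⟨ T ⟩) → X ∈F ℱ × T ⊆ X
∈⟨⟩⁻ ℱ T {X} X∈ with ℱ X | T ⊆? X
... | true | yes T⊆X = refl , T⊆X

∈⟨⟩⁺ : (ℱ : Family n) (T : Subset n) {X : Subset n} → X ∈F ℱ → T ⊆ X → X ∈F (ℱ ⟨ T ⟩)
∈⟨⟩⁺ ℱ T {X} X∈ℱ T⊆X rewrite X∈ℱ | dec-true (T ⊆? X) T⊆X = refl

length-filterᵇ-map : {A B : Set} (p : B → Bool) (g : A → B) (xs : List A) →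
                     length (filterᵇ p (map g xs)) ≡ length (filterᵇ (p ∘ g) xs)
length-filterᵇ-map p g []       = refl
length-filterᵇ-map p g (x ∷ xs) with p (g x)
... | true  = cong suc (length-filterᵇ-map p g xs)
... | false = length-filterᵇ-map p g xs

∣ℱ∣F≡count : (ℱ : Family n) → ∣ ℱ ∣F ≡ count (member? ℱ)
∣ℱ∣F≡count {zero} ℱ with ℱ []
... | true  = refl
... | false = refl
∣ℱ∣F≡count {suc n} ℱ = begin
  length (filterᵇ ℱ (map o all ++ map i all))
    ≡⟨ cong length (filter-++ (T? ∘ ℱ) (map o all) (map i all)) ⟩
  length (filterᵇ ℱ (map o all) ++ filterᵇ ℱ (map i all))
    ≡⟨ length-++ (filterᵇ ℱ (map o all)) ⟩
  length (filterᵇ ℱ (map o all)) + length (filterᵇ ℱ (map i all))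
    ≡⟨ cong₂ _+_ (length-filterᵇ-map ℱ o all) (length-filterᵇ-map ℱ i all) ⟩
  ∣ ℱ ∘ o ∣F + ∣ ℱ ∘ i ∣F
    ≡⟨ cong₂ _+_ (∣ℱ∣F≡count (ℱ ∘ o)) (∣ℱ∣F≡count (ℱ ∘ i)) ⟩
  count (member? ℱ) ∎
  where
  open ≡-Reasoning
  all : List (Subset n)
  all = allSubsets n
  o i : Subset n → Subset (suc n)
  o = outside ∷_
  i = inside ∷_

C-pascal : ∀ m k → suc m C suc k ≡ m C k + m C suc k
C-pascal m k = sym (nCk+nC[k+1]≡[n+1]C[k+1] m k)

C-suc : ∀ m k → m C k ≤ suc m C k
C-suc m zero    = ≤-refl
C-suc m (suc k) = ≤-trans (m≤n+m (m C suc k) (m C k)) (≤-reflexive (sym (C-pascal m k)))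

C-mono : ∀ {m m′} k → m ≤ m′ → m C k ≤ m′ C k
C-mono {m} k m≤m′ = go (≤⇒≤′ m≤m′)
  where
  go : ∀ {m′} → m ≤′ m′ → m C k ≤ m′ C k
  go ≤′-refl         = ≤-refl
  go (≤′-step m≤′m′) = ≤-trans (go m≤′m′) (C-suc _ k)

C-pos : ∀ {m k} → k ≤ m → 0 < m C k
C-pos {m}     {zero}  _         = s≤s z≤n
C-pos {suc m} {suc k} (s≤s k≤m) =
  ≤-trans (C-pos k≤m) (≤-trans (m≤m+n (m C k) (m C suc k)) (≤-reflexive (sym (C-pascal m k))))

choose? : (X : Subset n) (k : ℕ) → Decidable (λ A → A ⊆ X × ∣ A ∣ ≡ k)
choose? X k A = (A ⊆? X) ×-dec (∣ A ∣ ≟ k)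

count-choose : (X : Subset n) (k : ℕ) → count (choose? X k) ≡ ∣ X ∣ C k
count-choose []            zero    = refl
count-choose []            (suc k) = refl
count-choose {suc n} (outside ∷ X) k =
  trans (cong₂ _+_ (count-choose X k) (∑-vanish {n} λ _ → refl)) (+-identityʳ _)
count-choose {suc n} (inside ∷ X) zero =
  cong₂ _+_ (count-choose X zero) (∑-vanish λ A → cong χ (Boolₚ.∧-zeroʳ (does (A ⊆? X))))
count-choose {suc n} (inside ∷ X) (suc k) = begin
  count (choose? X (suc k)) + count (choose? X k) ≡⟨ cong₂ _+_ (count-choose X (suc k)) (count-choose X k) ⟩
  ∣ X ∣ C suc k + ∣ X ∣ C k                        ≡⟨ +-comm (∣ X ∣ C suc k) (∣ X ∣ C k) ⟩
  ∣ X ∣ C k + ∣ X ∣ C suc k                        ≡⟨ C-pascal ∣ X ∣ k ⟨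
  suc ∣ X ∣ C suc k                                ∎
  where open ≡-Reasoning

∪-least : (p q : Subset n) {r : Subset n} → p ⊆ r → q ⊆ r → p ∪ q ⊆ r
∪-least p q p⊆r q⊆r x∈p∪q = [ p⊆r , q⊆r ]′ (x∈p∪q⁻ p q x∈p∪q)

∣p─q∣+∣q∣≡∣p∣ : (p q : Subset n) → q ⊆ p → ∣ p ─ q ∣ + ∣ q ∣ ≡ ∣ p ∣
∣p─q∣+∣q∣≡∣p∣ []            []            _   = refl
∣p─q∣+∣q∣≡∣p∣ (outside ∷ p) (outside ∷ q) q⊆p = ∣p─q∣+∣q∣≡∣p∣ p q (drop-∷-⊆ q⊆p)
∣p─q∣+∣q∣≡∣p∣ (inside ∷ p)  (outside ∷ q) q⊆p = cong suc (∣p─q∣+∣q∣≡∣p∣ p q (drop-∷-⊆ q⊆p))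
∣p─q∣+∣q∣≡∣p∣ (inside ∷ p)  (inside ∷ q)  q⊆p =
  trans (+-suc ∣ p ─ q ∣ ∣ q ∣) (cong suc (∣p─q∣+∣q∣≡∣p∣ p q (drop-∷-⊆ q⊆p)))
∣p─q∣+∣q∣≡∣p∣ (outside ∷ p) (inside ∷ q)  q⊆p = contradiction (q⊆p here) λ ()

∣p─q∣≡∣p∣∸∣q∣ : (p q : Subset n) → q ⊆ p → ∣ p ─ q ∣ ≡ ∣ p ∣ ∸ ∣ q ∣
∣p─q∣≡∣p∣∸∣q∣ p q q⊆p =
  trans (sym (m+n∸n≡m ∣ p ─ q ∣ ∣ q ∣)) (cong (_∸ ∣ q ∣) (∣p─q∣+∣q∣≡∣p∣ p q q⊆p))

-- Sizes add over disjoint unions; here disjointness is witnessed by p ⊆ r and q ⊆ s ─ r.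
∣p∪q∣≡∣p∣+∣q∣ : (p q r s : Subset n) → p ⊆ r → q ⊆ s ─ r → ∣ p ∪ q ∣ ≡ ∣ p ∣ + ∣ q ∣
∣p∪q∣≡∣p∣+∣q∣ [] [] [] [] _ _ = refl
∣p∪q∣≡∣p∣+∣q∣ (outside ∷ p) (outside ∷ q) (_ ∷ r) (_ ∷ s) p⊆r q⊆s─r =
  ∣p∪q∣≡∣p∣+∣q∣ p q r s (drop-∷-⊆ p⊆r) (drop-∷-⊆ q⊆s─r)
∣p∪q∣≡∣p∣+∣q∣ (inside ∷ p) (outside ∷ q) (_ ∷ r) (_ ∷ s) p⊆r q⊆s─r =
  cong suc (∣p∪q∣≡∣p∣+∣q∣ p q r s (drop-∷-⊆ p⊆r) (drop-∷-⊆ q⊆s─r))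
∣p∪q∣≡∣p∣+∣q∣ (outside ∷ p) (inside ∷ q) (outside ∷ r) (_ ∷ s) p⊆r q⊆s─r =
  trans (cong suc (∣p∪q∣≡∣p∣+∣q∣ p q r s (drop-∷-⊆ p⊆r) (drop-∷-⊆ q⊆s─r))) (sym (+-suc ∣ p ∣ ∣ q ∣))
∣p∪q∣≡∣p∣+∣q∣ (outside ∷ p) (inside ∷ q) (inside ∷ r) (_ ∷ s) _   q⊆s─r = contradiction (q⊆s─r here) λ ()
∣p∪q∣≡∣p∣+∣q∣ (inside ∷ p)  (inside ∷ q) (inside ∷ r) (_ ∷ s) _   q⊆s─r = contradiction (q⊆s─r here) λ ()
∣p∪q∣≡∣p∣+∣q∣ (inside ∷ p)  (inside ∷ q) (outside ∷ r) (_ ∷ s) p⊆r _   = contradiction (p⊆r here) λ ()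

swap-removed : (F D A X : Subset n) → D ⊆ F → A ⊆ X ─ F → F ─ ((F ─ D) ∪ A) ≡ D
swap-removed [] [] [] [] _ _ = refl
swap-removed (inside ∷ F) (inside ∷ D) (outside ∷ A) (_ ∷ X) D⊆F A⊆X─F =
  cong (inside ∷_) (swap-removed F D A X (drop-∷-⊆ D⊆F) (drop-∷-⊆ A⊆X─F))
swap-removed (inside ∷ F) (outside ∷ D) (outside ∷ A) (_ ∷ X) D⊆F A⊆X─F =
  cong (outside ∷_) (swap-removed F D A X (drop-∷-⊆ D⊆F) (drop-∷-⊆ A⊆X─F))
swap-removed (outside ∷ F) (outside ∷ D) (outside ∷ A) (_ ∷ X) D⊆F A⊆X─F =
  cong (outside ∷_) (swap-removed F D A X (drop-∷-⊆ D⊆F) (drop-∷-⊆ A⊆X─F))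
swap-removed (outside ∷ F) (outside ∷ D) (inside ∷ A) (_ ∷ X) D⊆F A⊆X─F =
  cong (outside ∷_) (swap-removed F D A X (drop-∷-⊆ D⊆F) (drop-∷-⊆ A⊆X─F))
swap-removed (inside ∷ F)  (_ ∷ D)      (inside ∷ A) (_ ∷ X) _   A⊆X─F = contradiction (A⊆X─F here) λ ()
swap-removed (outside ∷ F) (inside ∷ D) (_ ∷ A)      (_ ∷ X) D⊆F _     = contradiction (D⊆F here) λ ()

swap-added : (F D A X : Subset n) → A ⊆ X ─ F → ((F ─ D) ∪ A) ─ F ≡ A
swap-added [] [] [] [] _ = refl
swap-added (inside ∷ F)  (_ ∷ D)       (outside ∷ A) (_ ∷ X) A⊆X─F =
  cong (outside ∷_) (swap-added F D A X (drop-∷-⊆ A⊆X─F))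
swap-added (outside ∷ F) (outside ∷ D) (a ∷ A)       (_ ∷ X) A⊆X─F =
  cong (a ∷_) (swap-added F D A X (drop-∷-⊆ A⊆X─F))
swap-added (outside ∷ F) (inside ∷ D)  (a ∷ A)       (_ ∷ X) A⊆X─F =
  cong (a ∷_) (swap-added F D A X (drop-∷-⊆ A⊆X─F))
swap-added (inside ∷ F)  (_ ∷ D)       (inside ∷ A)  (_ ∷ X) A⊆X─F = contradiction (A⊆X─F here) λ ()

[p─q]∪[q─[q─p]]≡p : (p q : Subset n) → (p ─ q) ∪ (q ─ (q ─ p)) ≡ p
[p─q]∪[q─[q─p]]≡p []            []            = refl
[p─q]∪[q─[q─p]]≡p (outside ∷ p) (outside ∷ q) = cong (outside ∷_) ([p─q]∪[q─[q─p]]≡p p q)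
[p─q]∪[q─[q─p]]≡p (outside ∷ p) (inside ∷ q)  = cong (outside ∷_) ([p─q]∪[q─[q─p]]≡p p q)
[p─q]∪[q─[q─p]]≡p (inside ∷ p)  (outside ∷ q) = cong (inside ∷_) ([p─q]∪[q─[q─p]]≡p p q)
[p─q]∪[q─[q─p]]≡p (inside ∷ p)  (inside ∷ q)  = cong (inside ∷_) ([p─q]∪[q─[q─p]]≡p p q)

─-determines : (p p′ q : Subset n) → p ─ q ≡ p′ ─ q → q ─ p ≡ q ─ p′ → p ≡ p′
─-determines p p′ q p─q≡p′─q q─p≡q─p′ = begin
  p                             ≡⟨ [p─q]∪[q─[q─p]]≡p p q ⟨
  (p ─ q) ∪ (q ─ (q ─ p))       ≡⟨ cong₂ (λ a b → a ∪ (q ─ b)) p─q≡p′─q q─p≡q─p′ ⟩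
  (p′ ─ q) ∪ (q ─ (q ─ p′))     ≡⟨ [p─q]∪[q─[q─p]]≡p p′ q ⟩
  p′                            ∎
  where open ≡-Reasoning

─-antitoneʳ : (r p q : Subset n) → p ⊆ q → r ─ q ⊆ r ─ p
─-antitoneʳ []            []            []            _   = ⊆-refl
─-antitoneʳ (_ ∷ r)       (_ ∷ p)       (inside ∷ q)  p⊆q = out⊆ (─-antitoneʳ r p q (drop-∷-⊆ p⊆q))
─-antitoneʳ (outside ∷ r) (outside ∷ p) (outside ∷ q) p⊆q = out⊆ (─-antitoneʳ r p q (drop-∷-⊆ p⊆q))
─-antitoneʳ (inside ∷ r)  (outside ∷ p) (outside ∷ q) p⊆q = in⊆in (─-antitoneʳ r p q (drop-∷-⊆ p⊆q))
─-antitoneʳ (_ ∷ r)       (inside ∷ p)  (outside ∷ q) p⊆q = contradiction (p⊆q here) λ ()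

⊆-kept : (T F G X : Subset n) → T ⊆ F → F ─ G ⊆ X ─ T → T ⊆ G
⊆-kept [] [] [] [] _ _ = ⊆-refl
⊆-kept (outside ∷ T) (_ ∷ F) (_ ∷ G) (_ ∷ X) T⊆F F─G⊆X─T =
  out⊆ (⊆-kept T F G X (drop-∷-⊆ T⊆F) (drop-∷-⊆ F─G⊆X─T))
⊆-kept (inside ∷ T) (inside ∷ F) (inside ∷ G) (_ ∷ X) T⊆F F─G⊆X─T =
  in⊆in (⊆-kept T F G X (drop-∷-⊆ T⊆F) (drop-∷-⊆ F─G⊆X─T))
⊆-kept (inside ∷ T) (inside ∷ F)  (outside ∷ G) (_ ∷ X) _   F─G⊆X─T = contradiction (F─G⊆X─T here) λ ()
⊆-kept (inside ∷ T) (outside ∷ F) (_ ∷ G)       (_ ∷ X) T⊆F _       = contradiction (T⊆F here) λ ()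

⊆-both⇒∣∣≡0 : (p q r : Subset n) → p ⊆ q → p ⊆ r ─ q → ∣ p ∣ ≡ 0
⊆-both⇒∣∣≡0 []            []            []      _   _     = refl
⊆-both⇒∣∣≡0 (outside ∷ p) (_ ∷ q)       (_ ∷ r) p⊆q p⊆r─q = ⊆-both⇒∣∣≡0 p q r (drop-∷-⊆ p⊆q) (drop-∷-⊆ p⊆r─q)
⊆-both⇒∣∣≡0 (inside ∷ p)  (inside ∷ q)  (_ ∷ r) _   p⊆r─q = contradiction (p⊆r─q here) λ ()
⊆-both⇒∣∣≡0 (inside ∷ p)  (outside ∷ q) (_ ∷ r) p⊆q _     = contradiction (p⊆q here) λ ()

argmax : (Subset n → ℕ) → Subset n
argmax {zero}  f = []
argmax {suc n} f =
  if f (outside ∷ xₒ) ≤ᵇ f (inside ∷ xᵢ) then inside ∷ xᵢ else outside ∷ xₒ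
  where
  xₒ xᵢ : Subset n
  xₒ = argmax (f ∘ (outside ∷_))
  xᵢ = argmax (f ∘ (inside ∷_))

argmax-max : (f : Subset n → ℕ) (x : Subset n) → f x ≤ f (argmax f)
argmax-max {zero} f [] = ≤-refl
argmax-max {suc n} f x
  with fₒ ≤ᵇ fᵢ | ≤ᵇ-reflects-≤ fₒ fᵢ
  where
  fₒ fᵢ : ℕ
  fₒ = f (outside ∷ argmax (f ∘ (outside ∷_)))
  fᵢ = f (inside ∷ argmax (f ∘ (inside ∷_)))
... | true  | ofʸ fₒ≤fᵢ with x
...   | outside ∷ x = ≤-trans (argmax-max (f ∘ (outside ∷_)) x) fₒ≤fᵢ
...   | inside ∷ x  = argmax-max (f ∘ (inside ∷_)) x
argmax-max {suc n} f x | false | ofⁿ fₒ≰fᵢ with x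
...   | outside ∷ x = argmax-max (f ∘ (outside ∷_)) x
...   | inside ∷ x  = ≤-trans (argmax-max (f ∘ (inside ∷_)) x) (<⇒≤ (≰⇒> fₒ≰fᵢ))

-- Every member F of a family lies in a base: take a member above F of maximum size,
-- found by maximising the weight 1 + |Y| over the members Y ⊇ F (and 0 elsewhere).
base-above : (ℱ : Family n) {F : Subset n} → F ∈F ℱ → Σ (Subset n) λ B → IsBase ℱ B × F ⊆ B
base-above {n} ℱ {F} F∈ℱ = B , (proj₁ B-above , B-maximal) , proj₂ B-above
  where
  Above : Subset n → Set
  Above Y = Y ∈F ℱ × F ⊆ Y
  above? : Decidable Above
  above? Y = member? ℱ Y ×-dec (F ⊆? Y)
  weight : Subset n → ℕ
  weight Y = if does (above? Y) then suc ∣ Y ∣ else 0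
  weight-above : ∀ {Y} → Above Y → weight Y ≡ suc ∣ Y ∣
  weight-above {Y} Y-above rewrite dec-true (above? Y) Y-above = refl
  weighted⇒above : ∀ Y → 0 < weight Y → Above Y
  weighted⇒above Y 0<weight with member? ℱ Y | F ⊆? Y | 0<weight
  ... | yes Y∈ℱ | yes F⊆Y | _ = Y∈ℱ , F⊆Y
  ... | yes _   | no _    | ()
  ... | no _    | _       | ()
  B : Subset n
  B = argmax weight
  B-above : Above B
  B-above = weighted⇒above B (begin
    1           ≤⟨ s≤s z≤n ⟩
    suc ∣ F ∣   ≡⟨ weight-above (F∈ℱ , ⊆-refl) ⟨
    weight F    ≤⟨ argmax-max weight F ⟩
    weight B    ∎)
    where open ≤-Reasoning
  B-maximal : ∀ X → X ∈F ℱ → ¬ B ⊂ X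
  B-maximal X X∈ℱ B⊂X = <⇒≱ (p⊂q⇒∣p∣<∣q∣ B⊂X) (s≤s⁻¹ (begin
    suc ∣ X ∣    ≡⟨ weight-above (X∈ℱ , ⊆-trans (proj₂ B-above) (proj₁ B⊂X)) ⟨
    weight X     ≤⟨ argmax-max weight X ⟩
    weight B     ≡⟨ weight-above B-above ⟩
    suc ∣ B ∣    ∎))
    where open ≤-Reasoning

<-from-split : ∀ {x y a c} → 0 < x → 0 < a → y * a ≤ x * c → y * a < x * (a + c)
<-from-split {x} {y} {a} {c} 0<x 0<a ya≤xc = begin-strict
  y * a          ≤⟨ ya≤xc ⟩
  x * c          <⟨ m<n+m (x * c) (*-mono-≤ 0<x 0<a) ⟩
  x * a + x * c  ≡⟨ *-distribˡ-+ x a c ⟨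
  x * (a + c)    ∎
  where open ≤-Reasoning

-- The exchange argument, for fixed ℋ, μ, S ⊆ [0, r] and T₁ ⊆ T₂ with D = T₂ ─ T₁ nonempty.
-- μ-least is the half of μ = μ(ℋ) that is used: every base has at least μ elements.
module ExchangeArgument
  (ℋ : Family n) (hereditary : Hereditary ℋ)
  (μ : ℕ) (μ-least : (B : Subset n) → IsBase ℋ B → μ ≤ ∣ B ∣)
  (S : ℕ → Bool) (r : ℕ) (S≤r : (s : ℕ) → S s ≡ true → s ≤ r)
  (T₁ T₂ : Subset n) (T₁⊆T₂ : T₁ ⊆ T₂) (∣T₂∣≤r : ∣ T₂ ∣ ≤ r) (0<k : 0 < ∣ T₂ ─ T₁ ∣)
  where

  ℱ : Family n
  ℱ = layers ℋ S

  D : Subset n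
  D = T₂ ─ T₁

  k : ℕ
  k = ∣ D ∣

  Exchange : Subset n → Subset n → Set
  Exchange F G = T₁ ⊆ F × G ∈F ℱ × F ─ G ≡ D × ∣ G ─ F ∣ ≡ k

  exchange? : ∀ F G → Dec (Exchange F G)
  exchange? F G = (T₁ ⊆? F) ×-dec member? ℱ G ×-dec (F ─ G ≟ˢ D) ×-dec (∣ G ─ F ∣ ≟ k)

  Missing : Subset n → Set
  Missing G = G ∈F (ℱ ⟨ T₁ ⟩) × ¬ T₂ ⊆ G

  missing? : Decidable Missing
  missing? = member? (ℱ ⟨ T₁ ⟩) ∩? ∁? (T₂ ⊆?_)

  ∈ℱ⇒∣∣≤r : ∀ {X} → X ∈F ℱ → ∣ X ∣ ≤ r
  ∈ℱ⇒∣∣≤r {X} X∈ℱ = S≤r ∣ X ∣ (proj₂ (Equivalence.to (∈layers⇔ ℋ S X) X∈ℱ))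

  count-split-T₂ : count (member? (ℱ ⟨ T₁ ⟩)) ≡ count (member? (ℱ ⟨ T₂ ⟩)) + count missing?
  count-split-T₂ = trans (count-split (member? (ℱ ⟨ T₁ ⟩)) (T₂ ⊆?_))
    (cong (_+ count missing?) (count-cong (member? (ℱ ⟨ T₁ ⟩) ∩? (T₂ ⊆?_)) (member? (ℱ ⟨ T₂ ⟩)) above-T₂))
    where
    above-T₂ : ∀ X → (X ∈F (ℱ ⟨ T₁ ⟩) × T₂ ⊆ X) ⇔ X ∈F (ℱ ⟨ T₂ ⟩)
    above-T₂ X = mk⇔ to from
      where
      to : X ∈F (ℱ ⟨ T₁ ⟩) × T₂ ⊆ X → X ∈F (ℱ ⟨ T₂ ⟩)
      to (X∈ , T₂⊆X) = ∈⟨⟩⁺ ℱ T₂ (proj₁ (∈⟨⟩⁻ ℱ T₁ X∈)) T₂⊆X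
      from : X ∈F (ℱ ⟨ T₂ ⟩) → X ∈F (ℱ ⟨ T₁ ⟩) × T₂ ⊆ X
      from X∈ with X∈ℱ , T₂⊆X ← ∈⟨⟩⁻ ℱ T₂ X∈ = ∈⟨⟩⁺ ℱ T₁ X∈ℱ (⊆-trans T₁⊆T₂ T₂⊆X) , T₂⊆X

  -- Every exchange contains T₁ (F ─ G = D avoids T₁) but not T₂ (G misses D ≠ ∅).
  exchange⇒missing : ∀ {F G} → Exchange F G → Missing G
  exchange⇒missing {F} {G} (T₁⊆F , G∈ℱ , F─G≡D , _) =
    ∈⟨⟩⁺ ℱ T₁ G∈ℱ (⊆-kept T₁ F G T₂ T₁⊆F (⊆-reflexive F─G≡D)) ,
    λ T₂⊆G → <⇒≢ 0<k (sym (⊆-both⇒∣∣≡0 D G F (⊆-trans (p─q⊆p T₂ T₁) T₂⊆G) (⊆-reflexive (sym F─G≡D))))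

  Cμ Cr : ℕ
  Cμ = (μ ∸ r) C k
  Cr = (r ∸ ∣ T₁ ∣) C k

  -- Replacing D ⊆ F by a k-subset A of B ─ F, for a base B of ℋ above F ∈ ℱ⟨T₂⟩, gives an
  -- exchange of F: the result lies below B, hence in ℋ, and has the size of F, hence is in ℱ.
  swap-exchanges : ∀ {F B A} → F ∈F (ℱ ⟨ T₂ ⟩) → IsBase ℋ B → F ⊆ B →
                   A ⊆ B ─ F × ∣ A ∣ ≡ k → Exchange F ((F ─ D) ∪ A)
  swap-exchanges {F} {B} {A} F∈ (B∈ℋ , _) F⊆B (A⊆B─F , ∣A∣≡k) =
    ⊆-trans T₁⊆T₂ T₂⊆F ,
    Equivalence.from (∈layers⇔ ℋ S G) (G∈ℋ , subst (λ s → S s ≡ true) (sym same-size) S∣F∣) ,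
    swap-removed F D A B D⊆F A⊆B─F ,
    trans (cong ∣_∣ (swap-added F D A B A⊆B─F)) ∣A∣≡k
    where
    G : Subset n
    G = (F ─ D) ∪ A
    T₂⊆F : T₂ ⊆ F
    T₂⊆F = proj₂ (∈⟨⟩⁻ ℱ T₂ F∈)
    S∣F∣ : S ∣ F ∣ ≡ true
    S∣F∣ = proj₂ (Equivalence.to (∈layers⇔ ℋ S F) (proj₁ (∈⟨⟩⁻ ℱ T₂ F∈)))
    D⊆F : D ⊆ F
    D⊆F = ⊆-trans (p─q⊆p T₂ T₁) T₂⊆F
    G∈ℋ : G ∈F ℋ
    G∈ℋ = hereditary B G
      (∪-least (F ─ D) A (⊆-trans (p─q⊆p F D) F⊆B) (⊆-trans A⊆B─F (p─q⊆p B F))) B∈ℋ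
    same-size : ∣ G ∣ ≡ ∣ F ∣
    same-size = begin
      ∣ (F ─ D) ∪ A ∣     ≡⟨ ∣p∪q∣≡∣p∣+∣q∣ (F ─ D) A F B (p─q⊆p F D) A⊆B─F ⟩
      ∣ F ─ D ∣ + ∣ A ∣   ≡⟨ cong (∣ F ─ D ∣ +_) ∣A∣≡k ⟩
      ∣ F ─ D ∣ + ∣ D ∣   ≡⟨ ∣p─q∣+∣q∣≡∣p∣ F D D⊆F ⟩
      ∣ F ∣               ∎
      where open ≡-Reasoning

  -- Lower bound: F ∈ ℱ⟨T₂⟩ has at least C(μ − r, k) exchanges, namely (F ─ D) ∪ A for the
  -- k-subsets A of B ─ F, where B is a base of ℋ above F; A is recovered as G ─ F.
  many-exchanges : ∀ {F} → F ∈F (ℱ ⟨ T₂ ⟩) → Cμ ≤ count (exchange? F)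
  many-exchanges {F} F∈ = begin
    (μ ∸ r) C k                 ≤⟨ C-mono k room ⟩
    ∣ B ─ F ∣ C k               ≡⟨ count-choose (B ─ F) k ⟨
    count (choose? (B ─ F) k)   ≤⟨ count-inj (choose? (B ─ F) k) (exchange? F) swap
                                              (swap-exchanges F∈ B-base F⊆B) swap-injective ⟩
    count (exchange? F)         ∎
    where
    open ≤-Reasoning
    F∈ℱ : F ∈F ℱ
    F∈ℱ = proj₁ (∈⟨⟩⁻ ℱ T₂ F∈)
    base : Σ (Subset n) λ B → IsBase ℋ B × F ⊆ B
    base = base-above ℋ (proj₁ (Equivalence.to (∈layers⇔ ℋ S F) F∈ℱ))
    B : Subset n
    B = proj₁ base
    B-base : IsBase ℋ B
    B-base = proj₁ (proj₂ base)
    F⊆B : F ⊆ B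
    F⊆B = proj₂ (proj₂ base)
    room : μ ∸ r ≤ ∣ B ─ F ∣
    room = begin
      μ ∸ r           ≤⟨ ∸-mono (μ-least B B-base) (∈ℱ⇒∣∣≤r F∈ℱ) ⟩
      ∣ B ∣ ∸ ∣ F ∣   ≡⟨ ∣p─q∣≡∣p∣∸∣q∣ B F F⊆B ⟨
      ∣ B ─ F ∣       ∎
    swap : Subset n → Subset n
    swap A = (F ─ D) ∪ A
    swap-injective : ∀ {A A′} → A ⊆ B ─ F × ∣ A ∣ ≡ k → A′ ⊆ B ─ F × ∣ A′ ∣ ≡ k →
                     swap A ≡ swap A′ → A ≡ A′
    swap-injective {A} {A′} (A⊆B─F , _) (A′⊆B─F , _) swapA≡swapA′ =
      trans (sym (swap-added F D A B A⊆B─F))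
            (trans (cong (_─ F) swapA≡swapA′) (swap-added F D A′ B A′⊆B─F))

  -- Upper bound: G is an exchange of at most C(r − |T₁|, k) sets F, since F ↦ G ─ F is
  -- injective into the k-subsets of G ─ T₁.
  few-exchanges : ∀ {G} → Missing G → count (λ F → exchange? F G) ≤ Cr
  few-exchanges {G} (G∈ , _) = begin
    count (λ F → exchange? F G)   ≤⟨ count-inj (λ F → exchange? F G) (choose? (G ─ T₁) k) (G ─_)
                                                removed-valid removed-injective ⟩
    count (choose? (G ─ T₁) k)    ≡⟨ count-choose (G ─ T₁) k ⟩
    ∣ G ─ T₁ ∣ C k                ≤⟨ C-mono k small ⟩
    Cr                            ∎
    where
    open ≤-Reasoning
    G∈ℱ : G ∈F ℱ
    G∈ℱ = proj₁ (∈⟨⟩⁻ ℱ T₁ G∈)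
    T₁⊆G : T₁ ⊆ G
    T₁⊆G = proj₂ (∈⟨⟩⁻ ℱ T₁ G∈)
    small : ∣ G ─ T₁ ∣ ≤ r ∸ ∣ T₁ ∣
    small = ≤-trans (≤-reflexive (∣p─q∣≡∣p∣∸∣q∣ G T₁ T₁⊆G)) (∸-monoˡ-≤ ∣ T₁ ∣ (∈ℱ⇒∣∣≤r G∈ℱ))
    removed-valid : ∀ {F} → Exchange F G → G ─ F ⊆ G ─ T₁ × ∣ G ─ F ∣ ≡ k
    removed-valid {F} (T₁⊆F , _ , _ , ∣G─F∣≡k) = ─-antitoneʳ G T₁ F T₁⊆F , ∣G─F∣≡k
    removed-injective : ∀ {F F′} → Exchange F G → Exchange F′ G → G ─ F ≡ G ─ F′ → F ≡ F′
    removed-injective {F} {F′} (_ , _ , F─G≡D , _) (_ , _ , F′─G≡D , _) =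
      ─-determines F F′ G (trans F─G≡D (sym F′─G≡D))

  exchange-count : Cμ * count (member? (ℱ ⟨ T₂ ⟩)) ≤ Cr * count missing?
  exchange-count = double-count (member? (ℱ ⟨ T₂ ⟩)) missing? exchange? Cμ Cr
                                many-exchanges few-exchanges exchange⇒missing

  exchange-bound : ∣ ℱ ⟨ T₂ ⟩ ∣F ≢ 0 → Cμ * ∣ ℱ ⟨ T₂ ⟩ ∣F < Cr * ∣ ℱ ⟨ T₁ ⟩ ∣F
  exchange-bound nonempty = begin-strict
    Cμ * ∣ ℱ ⟨ T₂ ⟩ ∣F                ≡⟨ cong (Cμ *_) (∣ℱ∣F≡count (ℱ ⟨ T₂ ⟩)) ⟩
    Cμ * above                        <⟨ <-from-split {y = Cμ} (C-pos k≤r∸∣T₁∣) 0<above exchange-count ⟩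
    Cr * (above + missing)            ≡⟨ cong (Cr *_) count-split-T₂ ⟨
    Cr * count (member? (ℱ ⟨ T₁ ⟩))   ≡⟨ cong (Cr *_) (∣ℱ∣F≡count (ℱ ⟨ T₁ ⟩)) ⟨
    Cr * ∣ ℱ ⟨ T₁ ⟩ ∣F                ∎
    where
    open ≤-Reasoning
    above missing : ℕ
    above = count (member? (ℱ ⟨ T₂ ⟩))
    missing = count missing?
    0<above : 0 < above
    0<above = n≢0⇒n>0 (nonempty ∘ trans (∣ℱ∣F≡count (ℱ ⟨ T₂ ⟩)))
    k≤r∸∣T₁∣ : k ≤ r ∸ ∣ T₁ ∣
    k≤r∸∣T₁∣ = ≤-trans (≤-reflexive (∣p─q∣≡∣p∣∸∣q∣ T₂ T₁ T₁⊆T₂)) (∸-monoˡ-≤ ∣ T₁ ∣ ∣T₂∣≤r)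

lemma4p3 : (n t₁ t₂ r : ℕ) → t₁ < t₂ → t₂ ≤ r →
    (ℋ : Family n) → Hereditary ℋ →
    (μ : ℕ) → IsMu ℋ μ → (2 * r ∸ t₁) ≤ μ →
    (S : ℕ → Bool) → Σ ℕ (λ s → S s ≡ true) →
    ((s : ℕ) → S s ≡ true → t₂ ≤ s) → ((s : ℕ) → S s ≡ true → s ≤ r) →
    (T₁ T₂ : Subset n) → T₁ ⊆ T₂ → ∣ T₁ ∣ ≡ t₁ → ∣ T₂ ∣ ≡ t₂ →
    ∣ layers ℋ S ⟨ T₂ ⟩ ∣F ≢ 0 →
    ((μ ∸ r) C (t₂ ∸ t₁)) * ∣ layers ℋ S ⟨ T₂ ⟩ ∣F
      < ((r ∸ t₁) C (t₂ ∸ t₁)) * ∣ layers ℋ S ⟨ T₁ ⟩ ∣F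
lemma4p3 n _ _ r t₁<t₂ t₂≤r ℋ hereditary μ (_ , μ-least) _ S _ _ S≤r T₁ T₂ T₁⊆T₂ refl refl nonempty =
  subst (λ k → ((μ ∸ r) C k) * ∣ layers ℋ S ⟨ T₂ ⟩ ∣F < ((r ∸ ∣ T₁ ∣) C k) * ∣ layers ℋ S ⟨ T₁ ⟩ ∣F)
        ∣D∣≡t₂∸t₁ (exchange-bound nonempty)
  where
  ∣D∣≡t₂∸t₁ : ∣ T₂ ─ T₁ ∣ ≡ ∣ T₂ ∣ ∸ ∣ T₁ ∣
  ∣D∣≡t₂∸t₁ = ∣p─q∣≡∣p∣∸∣q∣ T₂ T₁ T₁⊆T₂
  open ExchangeArgument ℋ hereditary μ μ-least S r S≤r T₁ T₂ T₁⊆T₂ t₂≤r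
    (subst (0 <_) (sym ∣D∣≡t₂∸t₁) (m<n⇒0<n∸m t₁<t₂))
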